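{- Let $m\ge 0$ and $n\ge 0$ be integers. Then $$n!\sum_{T\in\mathcal{T}_{m+1}(n)}\prod_{v\in\mathcal{I}(T)}\frac{1}{h_v}=\prod_{i=0}^{n-1}(mi+1),$$ and $$\sum_{T\in\mathcal{T}_{m+1}(n)}\prod_{v\in\mathcal{I}(T)}\left(m+\frac{1}{h_v}\right)=\frac{(m+1)^n(mn+1)^{n-1}}{n!}.$$
   Context: All trees are plane trees (rooted, children of each vertex linearly ordered, vertices unlabelled). A complete $p$-ary tree is a plane tree in which every internal (non-leaf) vertex has exactly $p$ children; $\mathcal{T}_p(n)$ denotes the set of complete $p$-ary trees with $n$ internal vertices (for $n=0$ the single-vertex tree). $\mathcal{I}(T)$ is the set of internal vertices of $T$, and for $v\in\mathcal{I}(T)$ the hook length $h_v$ is the number of internal vertices of the subtree rooted at $v$ (including $v$). Empty products equal $1$. -}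

module Defs where

open import Data.Nat as ℕ using (ℕ; zero; suc; _+_; _*_; _∸_; _^_; _!; NonZero)
open import Data.Nat.Properties using (_!≢0)
open import Data.Vec using (Vec; []; _∷_)
open import Data.List using (List; []; _∷_; map; concatMap; upTo)
open import Data.Integer using (+_)
open import Data.Rational using (ℚ; _/_)
import Data.Rational as Q

data CTree (p : ℕ) : Set where
  leaf : CTree p
  node : Vec (CTree p) p → CTree p

mutual
  internal : ∀ {p} → CTree p → ℕ
  internal leaf = 0
  internal (node ts) = suc (internalF ts)

  internalF : ∀ {p k} → Vec (CTree p) k → ℕ
  internalF [] = 0
  internalF (t ∷ ts) = internal t + internalF ts

mutual
  hookProd : ∀ {p} → (ℕ → ℚ) → CTree p → ℚ
  hookProd w leaf = Q.1ℚ
  hookProd w (node ts) = w (internal (node ts)) Q.* hookProdF w ts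

  hookProdF : ∀ {p k} → (ℕ → ℚ) → Vec (CTree p) k → ℚ
  hookProdF w [] = Q.1ℚ
  hookProdF w (t ∷ ts) = hookProd w t Q.* hookProdF w ts

-- Enumeration of complete p-ary trees with exactly n internal vertices
-- (fuel f; f = n + 1 is sufficient).  forestsF f p k n lists all
-- k-tuples of trees whose internal counts sum to n.
mutual
  treesF : ℕ → (p : ℕ) → ℕ → List (CTree p)
  treesF zero    p n       = []
  treesF (suc f) p zero    = leaf ∷ []
  treesF (suc f) p (suc n) = map node (forestsF f p p n)

  forestsF : ℕ → (p k : ℕ) → ℕ → List (Vec (CTree p) k)
  forestsF f p zero    zero    = [] ∷ []
  forestsF f p zero    (suc n) = []
  forestsF f p (suc k) n =
    concatMap (λ i → concatMap (λ t → map (t ∷_) (forestsF f p k (n ∸ i)))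
                               (treesF f p i))
              (upTo (suc n))

-- 𝒯_p(n) as a list (each tree exactly once)
𝒯 : (p n : ℕ) → List (CTree p)
𝒯 p n = treesF (suc n) p n

ΣT : ∀ {p} → List (CTree p) → (CTree p → ℚ) → ℚ
ΣT []       g = Q.0ℚ
ΣT (t ∷ ts) g = g t Q.+ ΣT ts g

⟦_⟧ : ℕ → ℚ
⟦ n ⟧ = + n / 1

-- 1/h (only ever applied to hook lengths h ≥ 1; 1/0 := 0 is a dummy value)
inv : ℕ → ℚ
inv zero    = Q.0ℚ
inv (suc k) = + 1 / suc k

prodMI : ℕ → ℕ → ℕ
prodMI m zero    = 1
prodMI m (suc n) = prodMI m n * (m * n + 1)

divFact : ℚ → ℕ → ℚ
divFact x n = x Q.* ((+ 1 / (n !)) {{n !≢0}})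

module Submission where

-- Cutting a tree at its root shows that the hook-weighted sums T(n) over p-ary trees satisfy
-- T(0) = 1 and T(n+1) = w(n+1) · T^{⋆p}(n), where ⋆ is the Cauchy product of sequences. This
-- recursion determines T, so any family F_k with F_0 = δ, F_1 ⋆ F_k = F_{k+1}, F_1(0) = 1 and
-- w(n+1) F_p(n) = F_1(n+1) has F_1 = T. For w(h) = 1/h take F_k(n) = ∏_{i<n} (m i + k) / n!,
-- the coefficients of (1 - m x)^(-k/m); for w(h) = m + 1/h take F_k(n) = (m+1)^n k (k + m n)^(n-1) / n!,
-- so that F_1 ⋆ F_k = F_{k+1} is Abel's generalisation of the binomial theorem. Both convolution
-- identities are proved by induction on n, multiplying by n and using the Leibniz rule
-- n (f ⋆ g)(n) = (θf ⋆ g)(n) + (f ⋆ θg)(n) with θf(i) = i f(i).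

open import Data.Nat using (ℕ)

module NatEmbedding where
  open import Data.Nat using (suc; NonZero; _!)
  import Data.Nat as ℕ
  open import Data.Nat.Properties using (_!≢0)
  open import Data.Nat.Coprimality using (1-coprimeTo) renaming (sym to coprime-sym)
  open import Data.Integer using (+_)
  import Data.Integer as ℤ
  import Data.Integer.Properties as ℤ
  open import Data.Rational using (ℚ; _+_; _*_; 0ℚ; 1ℚ; mkℚ; _/_)
  open import Data.Rational.Properties
  open import Relation.Binary.PropositionalEquality
  open ≡-Reasoning
  open import Defs using (⟦_⟧)

  ⟦⟧-mkℚ : ∀ n → ⟦ n ⟧ ≡ mkℚ (+ n) 0 (coprime-sym (1-coprimeTo n))
  ⟦⟧-mkℚ n = normalize-coprime (coprime-sym (1-coprimeTo n))

  -- Opaque, so that proofs use the homomorphism laws below instead of normalising gcds.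
  opaque
    fromℕ : ℕ → ℚ
    fromℕ n = ⟦ n ⟧

    1/ℕ_ : (d : ℕ) → .{{_ : NonZero d}} → ℚ
    1/ℕ d = + 1 / d

    fromℕ≡⟦⟧ : ∀ n → fromℕ n ≡ ⟦ n ⟧
    fromℕ≡⟦⟧ n = refl

    1/ℕ≡1/ : ∀ d .{{_ : NonZero d}} → 1/ℕ d ≡ + 1 / d
    1/ℕ≡1/ d = refl

    fromℕ-0 : fromℕ 0 ≡ 0ℚ
    fromℕ-0 = refl

    fromℕ-1 : fromℕ 1 ≡ 1ℚ
    fromℕ-1 = refl

    1/ℕ-1 : 1/ℕ 1 ≡ 1ℚ
    1/ℕ-1 = refl

    fromℕ-homo-+ : ∀ a b → fromℕ (a ℕ.+ b) ≡ fromℕ a + fromℕ b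
    fromℕ-homo-+ a b rewrite ⟦⟧-mkℚ a | ⟦⟧-mkℚ b =
      /-cong (sym (trans (cong₂ ℤ._+_ (ℤ.*-identityʳ (+ a)) (ℤ.*-identityʳ (+ b)))
                         (ℤ.pos-+ a b)))
             refl

    fromℕ-homo-* : ∀ a b → fromℕ (a ℕ.* b) ≡ fromℕ a * fromℕ b
    fromℕ-homo-* a b rewrite ⟦⟧-mkℚ a | ⟦⟧-mkℚ b = /-cong (ℤ.pos-* a b) refl

    fromℕ-*-1/ℕ : ∀ d .{{_ : NonZero d}} → fromℕ d * 1/ℕ d ≡ 1ℚ
    fromℕ-*-1/ℕ (suc k) rewrite ⟦⟧-mkℚ (suc k) | normalize-coprime {1} {k} (1-coprimeTo (suc k)) =
      *-inverseˡ (mkℚ (+ 1) k (1-coprimeTo (suc k)))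

  fromℕ-*-cancelˡ : ∀ d .{{_ : NonZero d}} {x y} → fromℕ d * x ≡ fromℕ d * y → x ≡ y
  fromℕ-*-cancelˡ d {x} {y} eq = begin
    x                     ≡⟨ undo x ⟨
    1/ℕ d * (fromℕ d * x) ≡⟨ cong (1/ℕ d *_) eq ⟩
    1/ℕ d * (fromℕ d * y) ≡⟨ undo y ⟩
    y                     ∎
    where
    undo : ∀ z → 1/ℕ d * (fromℕ d * z) ≡ z
    undo z = begin
      1/ℕ d * (fromℕ d * z) ≡⟨ *-assoc (1/ℕ d) (fromℕ d) z ⟨
      1/ℕ d * fromℕ d * z   ≡⟨ cong (_* z) (trans (*-comm (1/ℕ d) (fromℕ d)) (fromℕ-*-1/ℕ d)) ⟩
      1ℚ * z                ≡⟨ *-identityˡ z ⟩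
      z                     ∎

  fromℕ-*-fromℕ-* : ∀ a b z → fromℕ a * (fromℕ b * z) ≡ fromℕ (a ℕ.* b) * z
  fromℕ-*-fromℕ-* a b z = trans (sym (*-assoc (fromℕ a) (fromℕ b) z)) (cong (_* z) (sym (fromℕ-homo-* a b)))

  invFact : ℕ → ℚ
  invFact n = (1/ℕ (n !)) {{n !≢0}}

  invFact-0 : invFact 0 ≡ 1ℚ
  invFact-0 = 1/ℕ-1

  fromℕ-!-*-invFact : ∀ n → fromℕ (n !) * invFact n ≡ 1ℚ
  fromℕ-!-*-invFact n = fromℕ-*-1/ℕ (n !) {{n !≢0}}

  fromℕ-suc-*-invFact-suc : ∀ n → fromℕ (suc n) * invFact (suc n) ≡ invFact n
  fromℕ-suc-*-invFact-suc n = fromℕ-*-cancelˡ (n !) {{n !≢0}} (begin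
    fromℕ (n !) * (fromℕ (suc n) * invFact (suc n)) ≡⟨ *-assoc (fromℕ (n !)) _ _ ⟨
    fromℕ (n !) * fromℕ (suc n) * invFact (suc n)   ≡⟨ cong (_* invFact (suc n)) n!*[1+n]≡[1+n]! ⟩
    fromℕ (suc n !) * invFact (suc n)               ≡⟨ fromℕ-!-*-invFact (suc n) ⟩
    1ℚ                                              ≡⟨ fromℕ-!-*-invFact n ⟨
    fromℕ (n !) * invFact n                         ∎)
    where
    n!*[1+n]≡[1+n]! : fromℕ (n !) * fromℕ (suc n) ≡ fromℕ (suc n !)
    n!*[1+n]≡[1+n]! = trans (*-comm (fromℕ (n !)) _) (sym (fromℕ-homo-* (suc n) (n !)))

  fromℕ-suc-*-scaled-invFact : ∀ n z → fromℕ (suc n) * (z * invFact (suc n)) ≡ z * invFact n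
  fromℕ-suc-*-scaled-invFact n z = begin
    fromℕ (suc n) * (z * invFact (suc n)) ≡⟨ *-assoc (fromℕ (suc n)) z _ ⟨
    fromℕ (suc n) * z * invFact (suc n)   ≡⟨ cong (_* invFact (suc n)) (*-comm (fromℕ (suc n)) z) ⟩
    z * fromℕ (suc n) * invFact (suc n)   ≡⟨ *-assoc z _ _ ⟩
    z * (fromℕ (suc n) * invFact (suc n)) ≡⟨ cong (z *_) (fromℕ-suc-*-invFact-suc n) ⟩
    z * invFact n                         ∎

module Convolution where
  open import Data.Nat using (zero; suc; _∸_; _≤_; _^_; z≤n; s≤s)
  import Data.Nat as ℕ
  import Data.Nat.Properties as ℕ
  open import Data.Rational using (ℚ; _+_; _*_; 0ℚ)
  open import Data.Rational.Properties
  open import Data.Rational.Solver using (module +-*-Solver)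
  open import Relation.Binary.PropositionalEquality
  open ≡-Reasoning
  open NatEmbedding

  Seq : Set
  Seq = ℕ → ℚ

  sum≤ : ℕ → Seq → ℚ
  sum≤ zero    h = h 0
  sum≤ (suc n) h = h 0 + sum≤ n (λ i → h (suc i))

  sum≤-cong : ∀ n {h h′ : Seq} → (∀ i → i ≤ n → h i ≡ h′ i) → sum≤ n h ≡ sum≤ n h′
  sum≤-cong zero    eq = eq 0 z≤n
  sum≤-cong (suc n) eq = cong₂ _+_ (eq 0 z≤n) (sum≤-cong n (λ i i≤n → eq (suc i) (s≤s i≤n)))

  sum≤-+ : ∀ n (h h′ : Seq) → sum≤ n (λ i → h i + h′ i) ≡ sum≤ n h + sum≤ n h′
  sum≤-+ zero    h h′ = refl
  sum≤-+ (suc n) h h′ rewrite sum≤-+ n (λ i → h (suc i)) (λ i → h′ (suc i)) =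
    solve 4 (λ a b c d → (a :+ b) :+ (c :+ d) := (a :+ c) :+ (b :+ d)) refl (h 0) (h′ 0) _ _
    where open +-*-Solver

  sum≤-*ˡ : ∀ n c (h : Seq) → sum≤ n (λ i → c * h i) ≡ c * sum≤ n h
  sum≤-*ˡ zero    c h = refl
  sum≤-*ˡ (suc n) c h rewrite sum≤-*ˡ n c (λ i → h (suc i)) = sym (*-distribˡ-+ c (h 0) _)

  sum≤-suc : ∀ n (h : Seq) → sum≤ (suc n) h ≡ sum≤ n h + h (suc n)
  sum≤-suc zero    h = refl
  sum≤-suc (suc n) h rewrite sum≤-suc n (λ i → h (suc i)) = sym (+-assoc (h 0) _ _)

  sum≤-reverse : ∀ n (h : Seq) → sum≤ n h ≡ sum≤ n (λ i → h (n ∸ i))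
  sum≤-reverse zero    h = refl
  sum≤-reverse (suc n) h = begin
    h 0 + sum≤ n (λ i → h (suc i))
      ≡⟨ cong (h 0 +_) (sum≤-reverse n (λ i → h (suc i))) ⟩
    h 0 + sum≤ n (λ i → h (suc (n ∸ i)))
      ≡⟨ +-comm (h 0) _ ⟩
    sum≤ n (λ i → h (suc (n ∸ i))) + h 0
      ≡⟨ cong₂ _+_ (sum≤-cong n (λ i i≤n → cong h (sym (ℕ.+-∸-assoc 1 i≤n))))
                   (cong h (sym (ℕ.n∸n≡0 n))) ⟩
    sum≤ n (λ i → h (suc n ∸ i)) + h (suc n ∸ suc n)
      ≡⟨ sum≤-suc n (λ i → h (suc n ∸ i)) ⟨
    sum≤ (suc n) (λ i → h (suc n ∸ i)) ∎

  infixl 7 _⋆_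

  _⋆_ : Seq → Seq → Seq
  (f ⋆ g) n = sum≤ n (λ i → f i * g (n ∸ i))

  ⋆-comm : ∀ f g n → (f ⋆ g) n ≡ (g ⋆ f) n
  ⋆-comm f g n = trans (sum≤-reverse n _) (sum≤-cong n (λ i i≤n →
    trans (*-comm (f (n ∸ i)) _) (cong (λ j → g j * f (n ∸ i)) (ℕ.m∸[m∸n]≡n i≤n))))

  ⋆-cong : ∀ n {f f′ g g′ : Seq} →
           (∀ i → i ≤ n → f i ≡ f′ i) → (∀ i → i ≤ n → g i ≡ g′ i) → (f ⋆ g) n ≡ (f′ ⋆ g′) n
  ⋆-cong n eqf eqg = sum≤-cong n (λ i i≤n → cong₂ _*_ (eqf i i≤n) (eqg (n ∸ i) (ℕ.m∸n≤m n i)))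

  ⋆-congʳ : ∀ n {f f′ : Seq} g → (∀ i → f i ≡ f′ i) → (f ⋆ g) n ≡ (f′ ⋆ g) n
  ⋆-congʳ n g eq = ⋆-cong n {g = g} (λ i _ → eq i) (λ _ _ → refl)

  ⋆-distribʳ-+ : ∀ n (f f′ g : Seq) → ((λ i → f i + f′ i) ⋆ g) n ≡ (f ⋆ g) n + (f′ ⋆ g) n
  ⋆-distribʳ-+ n f f′ g = trans (sum≤-cong n (λ i _ → *-distribʳ-+ (g (n ∸ i)) (f i) (f′ i))) (sum≤-+ n _ _)

  ⋆-*ˡ : ∀ n c (f g : Seq) → ((λ i → c * f i) ⋆ g) n ≡ c * (f ⋆ g) n
  ⋆-*ˡ n c f g = trans (sum≤-cong n (λ i _ → *-assoc c (f i) (g (n ∸ i)))) (sum≤-*ˡ n c _)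

  -- On coefficient sequences, θ is x d/dx and shift is multiplication by x.
  θ : Seq → Seq
  θ f i = fromℕ i * f i

  θ-0 : ∀ f → θ f 0 ≡ 0ℚ
  θ-0 f = trans (cong (_* f 0) fromℕ-0) (*-zeroˡ (f 0))

  θ-⋆ : ∀ n (f g : Seq) → θ (f ⋆ g) n ≡ (θ f ⋆ g) n + (f ⋆ θ g) n
  θ-⋆ n f g = begin
    fromℕ n * (f ⋆ g) n                               ≡⟨ sum≤-*ˡ n (fromℕ n) _ ⟨
    sum≤ n (λ i → fromℕ n * (f i * g (n ∸ i)))        ≡⟨ sum≤-cong n split ⟩
    sum≤ n (λ i → θ f i * g (n ∸ i) + f i * θ g (n ∸ i)) ≡⟨ sum≤-+ n _ _ ⟩
    (θ f ⋆ g) n + (f ⋆ θ g) n                         ∎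
    where
    open +-*-Solver
    split : ∀ i → i ≤ n → fromℕ n * (f i * g (n ∸ i)) ≡ θ f i * g (n ∸ i) + f i * θ g (n ∸ i)
    split i i≤n = begin
      fromℕ n * (f i * g (n ∸ i))
        ≡⟨ cong (λ k → fromℕ k * (f i * g (n ∸ i))) (ℕ.m+[n∸m]≡n i≤n) ⟨
      fromℕ (i ℕ.+ (n ∸ i)) * (f i * g (n ∸ i))
        ≡⟨ cong (_* (f i * g (n ∸ i))) (fromℕ-homo-+ i (n ∸ i)) ⟩
      (fromℕ i + fromℕ (n ∸ i)) * (f i * g (n ∸ i))
        ≡⟨ solve 4 (λ a b x y → (a :+ b) :* (x :* y) := a :* x :* y :+ x :* (b :* y))
                 refl (fromℕ i) (fromℕ (n ∸ i)) (f i) (g (n ∸ i)) ⟩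
      θ f i * g (n ∸ i) + f i * θ g (n ∸ i) ∎

  shift : Seq → Seq
  shift h zero    = 0ℚ
  shift h (suc i) = h i

  shift-*ˡ : ∀ c (f : Seq) i → shift (λ j → c * f j) i ≡ c * shift f i
  shift-*ˡ c f zero    = sym (*-zeroʳ c)
  shift-*ˡ c f (suc i) = refl

  shift-⋆-0 : ∀ (h g : Seq) → (shift h ⋆ g) 0 ≡ 0ℚ
  shift-⋆-0 h g = *-zeroˡ (g 0)

  shift-⋆-suc : ∀ n (h g : Seq) → (shift h ⋆ g) (suc n) ≡ (h ⋆ g) n
  shift-⋆-suc n h g = trans (cong (_+ (h ⋆ g) n) (*-zeroˡ (g (suc n)))) (+-identityˡ _)

  shift-⋆-swap : ∀ n (h g : Seq) → (shift h ⋆ g) n ≡ (shift g ⋆ h) n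
  shift-⋆-swap zero    h g = trans (shift-⋆-0 h g) (sym (shift-⋆-0 g h))
  shift-⋆-swap (suc n) h g = begin
    (shift h ⋆ g) (suc n) ≡⟨ shift-⋆-suc n h g ⟩
    (h ⋆ g) n             ≡⟨ ⋆-comm h g n ⟩
    (g ⋆ h) n             ≡⟨ shift-⋆-suc n g h ⟨
    (shift g ⋆ h) (suc n) ∎

  twist : ℕ → Seq → Seq
  twist r f i = fromℕ (r ^ i) * f i

  twist-⋆ : ∀ r n (f g : Seq) → (twist r f ⋆ twist r g) n ≡ twist r (f ⋆ g) n
  twist-⋆ r n f g = trans (sum≤-cong n collect) (sum≤-*ˡ n (fromℕ (r ^ n)) _)
    where
    open +-*-Solver
    r^i*r^[n-i]≡r^n : ∀ i → i ≤ n → fromℕ (r ^ i) * fromℕ (r ^ (n ∸ i)) ≡ fromℕ (r ^ n)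
    r^i*r^[n-i]≡r^n i i≤n = begin
      fromℕ (r ^ i) * fromℕ (r ^ (n ∸ i)) ≡⟨ fromℕ-homo-* (r ^ i) _ ⟨
      fromℕ (r ^ i ℕ.* r ^ (n ∸ i))       ≡⟨ cong fromℕ (ℕ.^-distribˡ-+-* r i (n ∸ i)) ⟨
      fromℕ (r ^ (i ℕ.+ (n ∸ i)))         ≡⟨ cong (λ k → fromℕ (r ^ k)) (ℕ.m+[n∸m]≡n i≤n) ⟩
      fromℕ (r ^ n)                       ∎
    collect : ∀ i → i ≤ n →
              twist r f i * twist r g (n ∸ i) ≡ fromℕ (r ^ n) * (f i * g (n ∸ i))
    collect i i≤n = trans
      (solve 4 (λ a x b y → (a :* x) :* (b :* y) := (a :* b) :* (x :* y))
             refl (fromℕ (r ^ i)) (f i) (fromℕ (r ^ (n ∸ i))) (g (n ∸ i)))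
      (cong (_* (f i * g (n ∸ i))) (r^i*r^[n-i]≡r^n i i≤n))

module ListSum where
  open import Data.Nat using (suc)
  open import Data.List using (List; []; _∷_; map; concatMap; applyUpTo; _++_)
  open import Data.List.Relation.Unary.All using (All; []; _∷_)
  open import Data.Rational using (ℚ; _+_; _*_; 0ℚ)
  open import Data.Rational.Properties
  open import Relation.Binary.PropositionalEquality
  open import Function using (_∘_)
  open import Defs using (CTree; ΣT)
  open Convolution using (Seq; sum≤)

  sumOver : ∀ {A : Set} → List A → (A → ℚ) → ℚ
  sumOver []       g = 0ℚ
  sumOver (x ∷ xs) g = g x + sumOver xs g

  ΣT≡sumOver : ∀ {p} (ts : List (CTree p)) g → ΣT ts g ≡ sumOver ts g
  ΣT≡sumOver []       g = refl
  ΣT≡sumOver (t ∷ ts) g = cong (g t +_) (ΣT≡sumOver ts g)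

  sumOver-cong : ∀ {A : Set} {xs : List A} {g h : A → ℚ} → All (λ x → g x ≡ h x) xs → sumOver xs g ≡ sumOver xs h
  sumOver-cong []         = refl
  sumOver-cong (eq ∷ eqs) = cong₂ _+_ eq (sumOver-cong eqs)

  sumOver-++ : ∀ {A : Set} (xs ys : List A) g → sumOver (xs ++ ys) g ≡ sumOver xs g + sumOver ys g
  sumOver-++ []       ys g = sym (+-identityˡ _)
  sumOver-++ (x ∷ xs) ys g = trans (cong (g x +_) (sumOver-++ xs ys g)) (sym (+-assoc (g x) _ _))

  sumOver-concatMap : ∀ {A B : Set} (G : A → List B) (xs : List A) g →
                      sumOver (concatMap G xs) g ≡ sumOver xs (λ x → sumOver (G x) g)
  sumOver-concatMap G []       g = refl
  sumOver-concatMap G (x ∷ xs) g =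
    trans (sumOver-++ (G x) (concatMap G xs) g) (cong (sumOver (G x) g +_) (sumOver-concatMap G xs g))

  sumOver-map : ∀ {A B : Set} (φ : A → B) (xs : List A) g → sumOver (map φ xs) g ≡ sumOver xs (g ∘ φ)
  sumOver-map φ []       g = refl
  sumOver-map φ (x ∷ xs) g = cong (g (φ x) +_) (sumOver-map φ xs g)

  sumOver-*ˡ : ∀ {A : Set} (xs : List A) c g → sumOver xs (λ x → c * g x) ≡ c * sumOver xs g
  sumOver-*ˡ []       c g = sym (*-zeroʳ c)
  sumOver-*ˡ (x ∷ xs) c g = trans (cong (c * g x +_) (sumOver-*ˡ xs c g)) (sym (*-distribˡ-+ c (g x) _))

  sumOver-*ʳ : ∀ {A : Set} (xs : List A) c g → sumOver xs (λ x → g x * c) ≡ sumOver xs g * c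
  sumOver-*ʳ []       c g = sym (*-zeroˡ c)
  sumOver-*ʳ (x ∷ xs) c g = trans (cong (g x * c +_) (sumOver-*ʳ xs c g)) (sym (*-distribʳ-+ c (g x) _))

  sumOver-applyUpTo : ∀ n φ (g : Seq) → sumOver (applyUpTo φ (suc n)) g ≡ sum≤ n (g ∘ φ)
  sumOver-applyUpTo 0       φ g = +-identityʳ (g (φ 0))
  sumOver-applyUpTo (suc n) φ g = cong (g (φ 0) +_) (sumOver-applyUpTo n (φ ∘ suc) g)

module HookSums (p : ℕ) where
  open import Data.Nat using (zero; suc; _+_; _∸_; _<_; s≤s)
  import Data.Nat.Properties as ℕ
  open import Data.Vec using (Vec; _∷_)
  open import Data.List using (List; map; concatMap; upTo)
  open import Data.List.Relation.Unary.All as All using (All; []; _∷_)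
  open import Data.List.Relation.Unary.All.Properties using (map⁺; concat⁺; applyUpTo⁺₁)
  open import Data.Rational using (ℚ; _*_; 0ℚ; 1ℚ)
  open import Data.Rational.Properties
  open import Relation.Binary.PropositionalEquality
  open ≡-Reasoning
  open import Defs
  open Convolution
  open ListSum

  mutual
    treesF-internal : ∀ f n → All (λ t → internal t ≡ n) (treesF f p n)
    treesF-internal zero    n       = []
    treesF-internal (suc f) zero    = refl ∷ []
    treesF-internal (suc f) (suc n) = map⁺ (All.map (cong suc) (forestsF-internal f p n))

    forestsF-internal : ∀ f k n → All (λ ts → internalF ts ≡ n) (forestsF f p k n)
    forestsF-internal f zero    zero    = refl ∷ []
    forestsF-internal f zero    (suc n) = []
    forestsF-internal f (suc k) n       = concat⁺ (map⁺ (applyUpTo⁺₁ _ (suc n) λ {i} i<1+n →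
      concat⁺ (map⁺ (All.map (λ {t} internal-t≡i → map⁺ (All.map
        (λ internal-ts≡n∸i → trans (cong₂ _+_ internal-t≡i internal-ts≡n∸i) (ℕ.m+[n∸m]≡n (ℕ.≤-pred i<1+n)))
        (forestsF-internal f k (n ∸ i)))) (treesF-internal f i)))))

  δ : Seq
  δ zero    = 1ℚ
  δ (suc n) = 0ℚ

  module Weighted (w : ℕ → ℚ) where

    treeSum : ℕ → Seq
    treeSum f n = sumOver (treesF f p n) (hookProd w)

    forestSum : ℕ → ℕ → Seq
    forestSum f k n = sumOver (forestsF f p k n) (hookProdF w)

    forestSum-suc : ∀ f k n → forestSum f (suc k) n ≡ (treeSum f ⋆ forestSum f k) n
    forestSum-suc f k n = begin
      forestSum f (suc k) n
        ≡⟨ sumOver-concatMap withFirst (upTo (suc n)) (hookProdF w) ⟩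
      sumOver (upTo (suc n)) (λ i → sumOver (withFirst i) (hookProdF w))
        ≡⟨ sumOver-cong (All.universal split (upTo (suc n))) ⟩
      sumOver (upTo (suc n)) (λ i → treeSum f i * forestSum f k (n ∸ i))
        ≡⟨ sumOver-applyUpTo n (λ i → i) _ ⟩
      (treeSum f ⋆ forestSum f k) n ∎
      where
      withFirst : ℕ → List (Vec (CTree p) (suc k))
      withFirst i = concatMap (λ t → map (t ∷_) (forestsF f p k (n ∸ i))) (treesF f p i)
      split : ∀ i → sumOver (withFirst i) (hookProdF w) ≡ treeSum f i * forestSum f k (n ∸ i)
      split i = begin
        sumOver (withFirst i) (hookProdF w)
          ≡⟨ sumOver-concatMap _ (treesF f p i) (hookProdF w) ⟩
        sumOver (treesF f p i) (λ t → sumOver (map (t ∷_) (forestsF f p k (n ∸ i))) (hookProdF w))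
          ≡⟨ sumOver-cong (All.universal (λ t →
               trans (sumOver-map (t ∷_) (forestsF f p k (n ∸ i)) (hookProdF w))
                     (sumOver-*ˡ (forestsF f p k (n ∸ i)) (hookProd w t) (hookProdF w))) (treesF f p i)) ⟩
        sumOver (treesF f p i) (λ t → hookProd w t * forestSum f k (n ∸ i))
          ≡⟨ sumOver-*ʳ (treesF f p i) (forestSum f k (n ∸ i)) (hookProd w) ⟩
        treeSum f i * forestSum f k (n ∸ i) ∎

    treeSum-suc : ∀ f n → treeSum (suc f) (suc n) ≡ w (suc n) * forestSum f p n
    treeSum-suc f n = begin
      treeSum (suc f) (suc n)
        ≡⟨ sumOver-map node (forestsF f p p n) (hookProd w) ⟩
      sumOver (forestsF f p p n) (λ ts → w (suc (internalF ts)) * hookProdF w ts)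
        ≡⟨ sumOver-cong (All.map (λ {ts} eq → cong (λ h → w (suc h) * hookProdF w ts) eq)
                                 (forestsF-internal f p n)) ⟩
      sumOver (forestsF f p p n) (λ ts → w (suc n) * hookProdF w ts)
        ≡⟨ sumOver-*ˡ (forestsF f p p n) (w (suc n)) (hookProdF w) ⟩
      w (suc n) * forestSum f p n ∎

    record IsTreePowerFamily (F : ℕ → Seq) : Set where
      field
        F₀≡δ    : ∀ n → F 0 n ≡ δ n
        F₁-0    : F 1 0 ≡ 1ℚ
        F₁⋆F    : ∀ k n → (F 1 ⋆ F k) n ≡ F (suc k) n
        F₁-suc  : ∀ n → w (suc n) * F p n ≡ F 1 (suc n)

    module _ {F : ℕ → Seq} (isF : IsTreePowerFamily F) where
      open IsTreePowerFamily isF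

      forestSum≡F : ∀ f → (∀ i → i < f → treeSum f i ≡ F 1 i) → ∀ k n → n < f → forestSum f k n ≡ F k n
      forestSum≡F f trees zero    zero    _   = trans (+-identityʳ 1ℚ) (sym (F₀≡δ 0))
      forestSum≡F f trees zero    (suc n) _   = sym (F₀≡δ (suc n))
      forestSum≡F f trees (suc k) n       n<f = begin
        forestSum f (suc k) n          ≡⟨ forestSum-suc f k n ⟩
        (treeSum f ⋆ forestSum f k) n  ≡⟨ ⋆-cong n (λ i i≤n → trees i (ℕ.≤-<-trans i≤n n<f))
                                                   (λ i i≤n → forestSum≡F f trees k i (ℕ.≤-<-trans i≤n n<f)) ⟩
        (F 1 ⋆ F k) n                  ≡⟨ F₁⋆F k n ⟩
        F (suc k) n                    ∎

      treeSum≡F₁ : ∀ f n → n < f → treeSum f n ≡ F 1 n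
      treeSum≡F₁ (suc f) zero    _         = trans (+-identityʳ 1ℚ) (sym F₁-0)
      treeSum≡F₁ (suc f) (suc n) (s≤s n<f) = begin
        treeSum (suc f) (suc n)   ≡⟨ treeSum-suc f n ⟩
        w (suc n) * forestSum f p n
          ≡⟨ cong (w (suc n) *_) (forestSum≡F f (λ i i<f → treeSum≡F₁ f i i<f) p n n<f) ⟩
        w (suc n) * F p n         ≡⟨ F₁-suc n ⟩
        F 1 (suc n)               ∎

      hookSum≡F₁ : ∀ n → ΣT (𝒯 p n) (hookProd w) ≡ F 1 n
      hookSum≡F₁ n = trans (ΣT≡sumOver (𝒯 p n) (hookProd w)) (treeSum≡F₁ (suc n) n ℕ.≤-refl)

module BinomialSeries (m : ℕ) where
  open import Data.Nat using (zero; suc; _+_; _*_)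
  open import Data.Rational using (ℚ; 1ℚ) renaming (_+_ to _+ℚ_; _*_ to _*ℚ_)
  open import Data.Rational.Properties
  open import Data.Rational.Solver using (module +-*-Solver)
  open import Relation.Binary.PropositionalEquality
  open ≡-Reasoning
  open +-*-Solver
  open NatEmbedding
  open Convolution

  pochhammer : ℕ → ℕ → ℕ
  pochhammer a zero    = 1
  pochhammer a (suc n) = pochhammer a n * (m * n + a)

  -- The coefficients of (1 - m x)^(-a/m); binomial-⋆ is the law of exponents.
  binomial : ℕ → Seq
  binomial a n = fromℕ (pochhammer a n) *ℚ invFact n

  binomial-0 : ∀ a → binomial a 0 ≡ 1ℚ
  binomial-0 a = cong₂ _*ℚ_ fromℕ-1 invFact-0

  fromℕ-m*n+a : ∀ n a → fromℕ (m * n + a) ≡ fromℕ m *ℚ fromℕ n +ℚ fromℕ a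
  fromℕ-m*n+a n a = trans (fromℕ-homo-+ (m * n) a) (cong (_+ℚ fromℕ a) (fromℕ-homo-* m n))

  θ-binomial-suc : ∀ a n → θ (binomial a) (suc n) ≡ fromℕ (m * n + a) *ℚ binomial a n
  θ-binomial-suc a n = begin
    fromℕ (suc n) *ℚ (fromℕ (pochhammer a n * k) *ℚ invFact (suc n))
      ≡⟨ fromℕ-suc-*-scaled-invFact n (fromℕ (pochhammer a n * k)) ⟩
    fromℕ (pochhammer a n * k) *ℚ invFact n
      ≡⟨ cong (_*ℚ invFact n) (fromℕ-homo-* (pochhammer a n) k) ⟩
    fromℕ (pochhammer a n) *ℚ fromℕ k *ℚ invFact n
      ≡⟨ solve 3 (λ p x i → p :* x :* i := x :* (p :* i)) refl (fromℕ (pochhammer a n)) (fromℕ k) (invFact n) ⟩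
    fromℕ k *ℚ binomial a n ∎
    where
    k : ℕ
    k = m * n + a

  θ-binomial : ∀ a i →
    θ (binomial a) i ≡ shift (λ j → fromℕ m *ℚ θ (binomial a) j +ℚ fromℕ a *ℚ binomial a j) i
  θ-binomial a zero    = θ-0 (binomial a)
  θ-binomial a (suc j) = begin
    θ (binomial a) (suc j)                            ≡⟨ θ-binomial-suc a j ⟩
    fromℕ (m * j + a) *ℚ binomial a j                 ≡⟨ cong (_*ℚ binomial a j) (fromℕ-m*n+a j a) ⟩
    (fromℕ m *ℚ fromℕ j +ℚ fromℕ a) *ℚ binomial a j
      ≡⟨ solve 4 (λ x y z p → (x :* y :+ z) :* p := x :* (y :* p) :+ z :* p)
               refl (fromℕ m) (fromℕ j) (fromℕ a) (binomial a j) ⟩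
    fromℕ m *ℚ θ (binomial a) j +ℚ fromℕ a *ℚ binomial a j ∎

  θ-binomial-⋆-suc : ∀ n a g →
    (θ (binomial a) ⋆ g) (suc n) ≡ fromℕ m *ℚ (θ (binomial a) ⋆ g) n +ℚ fromℕ a *ℚ (binomial a ⋆ g) n
  θ-binomial-⋆-suc n a g = begin
    (θ (binomial a) ⋆ g) (suc n)                    ≡⟨ ⋆-congʳ (suc n) g (θ-binomial a) ⟩
    (shift (λ j → mθB j +ℚ aB j) ⋆ g) (suc n)       ≡⟨ shift-⋆-suc n (λ j → mθB j +ℚ aB j) g ⟩
    ((λ j → mθB j +ℚ aB j) ⋆ g) n                   ≡⟨ ⋆-distribʳ-+ n mθB aB g ⟩
    (mθB ⋆ g) n +ℚ (aB ⋆ g) n                       ≡⟨ cong₂ _+ℚ_ (⋆-*ˡ n (fromℕ m) (θ (binomial a)) g)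
                                                                  (⋆-*ˡ n (fromℕ a) (binomial a) g) ⟩
    fromℕ m *ℚ (θ (binomial a) ⋆ g) n +ℚ fromℕ a *ℚ (binomial a ⋆ g) n ∎
    where
    mθB aB : Seq
    mθB j = fromℕ m *ℚ θ (binomial a) j
    aB  j = fromℕ a *ℚ binomial a j

  binomial-⋆ : ∀ n a b → (binomial a ⋆ binomial b) n ≡ binomial (a + b) n
  binomial-⋆ zero    a b = trans (cong₂ _*ℚ_ (binomial-0 a) (binomial-0 b)) (sym (binomial-0 (a + b)))
  binomial-⋆ (suc n) a b = fromℕ-*-cancelˡ (suc n) (begin
    θ (binomial a ⋆ binomial b) (suc n)
      ≡⟨ θ-⋆ (suc n) (binomial a) (binomial b) ⟩
    (θ (binomial a) ⋆ binomial b) (suc n) +ℚ (binomial a ⋆ θ (binomial b)) (suc n)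
      ≡⟨ cong ((θ (binomial a) ⋆ binomial b) (suc n) +ℚ_) (⋆-comm (binomial a) (θ (binomial b)) (suc n)) ⟩
    (θ (binomial a) ⋆ binomial b) (suc n) +ℚ (θ (binomial b) ⋆ binomial a) (suc n)
      ≡⟨ cong₂ _+ℚ_ (θ-binomial-⋆-suc n a (binomial b)) (θ-binomial-⋆-suc n b (binomial a)) ⟩
    (M *ℚ X +ℚ A *ℚ C) +ℚ (M *ℚ (θ (binomial b) ⋆ binomial a) n +ℚ B *ℚ (binomial b ⋆ binomial a) n)
      ≡⟨ cong₂ (λ y c → (M *ℚ X +ℚ A *ℚ C) +ℚ (M *ℚ y +ℚ B *ℚ c))
               (⋆-comm (θ (binomial b)) (binomial a) n) (⋆-comm (binomial b) (binomial a) n) ⟩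
    (M *ℚ X +ℚ A *ℚ C) +ℚ (M *ℚ Y +ℚ B *ℚ C)
      ≡⟨ solve 6 (λ m a b x y c → (m :* x :+ a :* c) :+ (m :* y :+ b :* c) := m :* (x :+ y) :+ (a :+ b) :* c)
               refl M A B X Y C ⟩
    M *ℚ (X +ℚ Y) +ℚ (A +ℚ B) *ℚ C
      ≡⟨ cong (λ z → M *ℚ z +ℚ (A +ℚ B) *ℚ C) (θ-⋆ n (binomial a) (binomial b)) ⟨
    M *ℚ (fromℕ n *ℚ C) +ℚ (A +ℚ B) *ℚ C
      ≡⟨ solve 5 (λ m n a b c → m :* (n :* c) :+ (a :+ b) :* c := (m :* n :+ (a :+ b)) :* c)
               refl M (fromℕ n) A B C ⟩
    (M *ℚ fromℕ n +ℚ (A +ℚ B)) *ℚ C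
      ≡⟨ cong₂ (λ s c → (M *ℚ fromℕ n +ℚ s) *ℚ c) (sym (fromℕ-homo-+ a b)) (binomial-⋆ n a b) ⟩
    (M *ℚ fromℕ n +ℚ fromℕ (a + b)) *ℚ binomial (a + b) n
      ≡⟨ cong (_*ℚ binomial (a + b) n) (fromℕ-m*n+a n (a + b)) ⟨
    fromℕ (m * n + (a + b)) *ℚ binomial (a + b) n
      ≡⟨ θ-binomial-suc (a + b) n ⟨
    θ (binomial (a + b)) (suc n) ∎)
    where
    M A B X Y C : ℚ
    M = fromℕ m
    A = fromℕ a
    B = fromℕ b
    X = (θ (binomial a) ⋆ binomial b) n
    Y = (binomial a ⋆ θ (binomial b)) n
    C = (binomial a ⋆ binomial b) n

-- With W(x) = x e^(m W(x)), abel a and abelCompanion b are the coefficient sequences of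
-- e^(a W) and e^(b W) / (1 - m W) (Lagrange inversion).
module AbelSeries (m : ℕ) where
  open import Data.Nat using (zero; suc; _+_; _*_; _^_)
  import Data.Nat.Properties as ℕ
  open import Data.Rational using (ℚ; 1ℚ) renaming (_+_ to _+ℚ_; _*_ to _*ℚ_)
  open import Data.Rational.Properties
  open import Data.Rational.Solver using (module +-*-Solver)
  open import Relation.Binary.PropositionalEquality
  open ≡-Reasoning
  open +-*-Solver
  open NatEmbedding
  open Convolution

  abelNumerator : ℕ → ℕ → ℕ
  abelNumerator a zero    = 1
  abelNumerator a (suc n) = a * (a + m * suc n) ^ n

  abel : ℕ → Seq
  abel a n = fromℕ (abelNumerator a n) *ℚ invFact n

  abelCompanion : ℕ → Seq
  abelCompanion b n = fromℕ ((b + m * n) ^ n) *ℚ invFact n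

  abel-0 : ∀ a → abel a 0 ≡ 1ℚ
  abel-0 a = cong₂ _*ℚ_ fromℕ-1 invFact-0

  abelCompanion-0 : ∀ b → abelCompanion b 0 ≡ 1ℚ
  abelCompanion-0 b = cong₂ _*ℚ_ fromℕ-1 invFact-0

  a+m*[1+j]≡[a+m]+m*j : ∀ a j → a + m * suc j ≡ (a + m) + m * j
  a+m*[1+j]≡[a+m]+m*j a j = trans (cong (a +_) (ℕ.*-suc m j)) (sym (ℕ.+-assoc a m (m * j)))

  fromℕ-a+m*k : ∀ a k → fromℕ (a + m * k) ≡ fromℕ a +ℚ fromℕ m *ℚ fromℕ k
  fromℕ-a+m*k a k = trans (fromℕ-homo-+ a (m * k)) (cong (fromℕ a +ℚ_) (fromℕ-homo-* m k))

  θ-abel : ∀ a i → θ (abel a) i ≡ shift (λ j → fromℕ a *ℚ abelCompanion (a + m) j) i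
  θ-abel a zero    = θ-0 (abel a)
  θ-abel a (suc j) = begin
    fromℕ (suc j) *ℚ (fromℕ (a * (a + m * suc j) ^ j) *ℚ invFact (suc j))
      ≡⟨ fromℕ-suc-*-scaled-invFact j (fromℕ (a * (a + m * suc j) ^ j)) ⟩
    fromℕ (a * (a + m * suc j) ^ j) *ℚ invFact j
      ≡⟨ cong (λ x → fromℕ (a * x ^ j) *ℚ invFact j) (a+m*[1+j]≡[a+m]+m*j a j) ⟩
    fromℕ (a * ((a + m) + m * j) ^ j) *ℚ invFact j
      ≡⟨ cong (_*ℚ invFact j) (fromℕ-homo-* a _) ⟩
    fromℕ a *ℚ fromℕ (((a + m) + m * j) ^ j) *ℚ invFact j
      ≡⟨ *-assoc (fromℕ a) _ (invFact j) ⟩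
    fromℕ a *ℚ abelCompanion (a + m) j ∎

  θ-abelCompanion : ∀ b i →
    θ (abelCompanion b) i
      ≡ shift (λ j → fromℕ (b + m) *ℚ abelCompanion (b + m) j +ℚ fromℕ m *ℚ θ (abelCompanion (b + m)) j) i
  θ-abelCompanion b zero    = θ-0 (abelCompanion b)
  θ-abelCompanion b (suc j) = begin
    fromℕ (suc j) *ℚ (fromℕ ((b + m * suc j) ^ suc j) *ℚ invFact (suc j))
      ≡⟨ fromℕ-suc-*-scaled-invFact j (fromℕ ((b + m * suc j) ^ suc j)) ⟩
    fromℕ ((b + m * suc j) ^ suc j) *ℚ invFact j
      ≡⟨ cong (λ x → fromℕ (x ^ suc j) *ℚ invFact j) (a+m*[1+j]≡[a+m]+m*j b j) ⟩
    fromℕ (X * X ^ j) *ℚ invFact j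
      ≡⟨ cong (_*ℚ invFact j) (fromℕ-homo-* X (X ^ j)) ⟩
    fromℕ X *ℚ fromℕ (X ^ j) *ℚ invFact j
      ≡⟨ cong (λ z → z *ℚ fromℕ (X ^ j) *ℚ invFact j) (fromℕ-a+m*k (b + m) j) ⟩
    (fromℕ (b + m) +ℚ fromℕ m *ℚ fromℕ j) *ℚ fromℕ (X ^ j) *ℚ invFact j
      ≡⟨ solve 5 (λ p q r s t → (p :+ q :* r) :* s :* t := p :* (s :* t) :+ q :* (r :* (s :* t)))
               refl (fromℕ (b + m)) (fromℕ m) (fromℕ j) (fromℕ (X ^ j)) (invFact j) ⟩
    fromℕ (b + m) *ℚ abelCompanion (b + m) j +ℚ fromℕ m *ℚ θ (abelCompanion (b + m)) j ∎
    where
    X : ℕ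
    X = (b + m) + m * j

  abelCompanion≡abel+shift : ∀ b i →
    abelCompanion b i ≡ abel b i +ℚ fromℕ m *ℚ shift (abelCompanion (b + m)) i
  abelCompanion≡abel+shift b zero    =
    trans (abelCompanion-0 b) (sym (trans (cong (abel b 0 +ℚ_) (*-zeroʳ (fromℕ m))) (trans (+-identityʳ (abel b 0)) (abel-0 b))))
  abelCompanion≡abel+shift b (suc j) = fromℕ-*-cancelˡ (suc j) (begin
    fromℕ (suc j) *ℚ (fromℕ (X ^ suc j) *ℚ invFact (suc j))
      ≡⟨ fromℕ-suc-*-scaled-invFact j (fromℕ (X ^ suc j)) ⟩
    fromℕ (X * X ^ j) *ℚ invFact j
      ≡⟨ cong (_*ℚ invFact j) (fromℕ-homo-* X (X ^ j)) ⟩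
    fromℕ X *ℚ fromℕ (X ^ j) *ℚ invFact j
      ≡⟨ cong (λ z → z *ℚ fromℕ (X ^ j) *ℚ invFact j) (fromℕ-a+m*k b (suc j)) ⟩
    (fromℕ b +ℚ fromℕ m *ℚ fromℕ (suc j)) *ℚ fromℕ (X ^ j) *ℚ invFact j
      ≡⟨ solve 5 (λ p q r s t → (p :+ q :* r) :* s :* t := p :* s :* t :+ r :* (q :* (s :* t)))
               refl (fromℕ b) (fromℕ m) (fromℕ (suc j)) (fromℕ (X ^ j)) (invFact j) ⟩
    fromℕ b *ℚ fromℕ (X ^ j) *ℚ invFact j +ℚ fromℕ (suc j) *ℚ (fromℕ m *ℚ (fromℕ (X ^ j) *ℚ invFact j))
      ≡⟨ cong₂ (λ u v → u *ℚ invFact j +ℚ fromℕ (suc j) *ℚ (fromℕ m *ℚ (fromℕ (v ^ j) *ℚ invFact j)))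
               (sym (fromℕ-homo-* b (X ^ j))) (a+m*[1+j]≡[a+m]+m*j b j) ⟩
    fromℕ (b * X ^ j) *ℚ invFact j +ℚ fromℕ (suc j) *ℚ (fromℕ m *ℚ abelCompanion (b + m) j)
      ≡⟨ cong (_+ℚ fromℕ (suc j) *ℚ (fromℕ m *ℚ abelCompanion (b + m) j))
              (fromℕ-suc-*-scaled-invFact j (fromℕ (b * X ^ j))) ⟨
    fromℕ (suc j) *ℚ abel b (suc j) +ℚ fromℕ (suc j) *ℚ (fromℕ m *ℚ abelCompanion (b + m) j)
      ≡⟨ *-distribˡ-+ (fromℕ (suc j)) _ _ ⟨
    fromℕ (suc j) *ℚ (abel b (suc j) +ℚ fromℕ m *ℚ abelCompanion (b + m) j) ∎)
    where
    X : ℕ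
    X = b + m * suc j

  θ-abel-⋆ : ∀ n a g → (θ (abel a) ⋆ g) n ≡ fromℕ a *ℚ (shift (abelCompanion (a + m)) ⋆ g) n
  θ-abel-⋆ n a g = begin
    (θ (abel a) ⋆ g) n                                    ≡⟨ ⋆-congʳ n g θ-abel′ ⟩
    ((λ i → fromℕ a *ℚ shift (abelCompanion (a + m)) i) ⋆ g) n
      ≡⟨ ⋆-*ˡ n (fromℕ a) (shift (abelCompanion (a + m))) g ⟩
    fromℕ a *ℚ (shift (abelCompanion (a + m)) ⋆ g) n     ∎
    where
    θ-abel′ : ∀ i → θ (abel a) i ≡ fromℕ a *ℚ shift (abelCompanion (a + m)) i
    θ-abel′ i = trans (θ-abel a i) (shift-*ˡ (fromℕ a) (abelCompanion (a + m)) i)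

  θ-abel-⋆-suc : ∀ n a g → (θ (abel a) ⋆ g) (suc n) ≡ fromℕ a *ℚ (abelCompanion (a + m) ⋆ g) n
  θ-abel-⋆-suc n a g =
    trans (θ-abel-⋆ (suc n) a g) (cong (fromℕ a *ℚ_) (shift-⋆-suc n (abelCompanion (a + m)) g))

  θ-abelCompanion-⋆-suc : ∀ n b g →
    (θ (abelCompanion b) ⋆ g) (suc n)
      ≡ fromℕ (b + m) *ℚ (abelCompanion (b + m) ⋆ g) n +ℚ fromℕ m *ℚ (θ (abelCompanion (b + m)) ⋆ g) n
  θ-abelCompanion-⋆-suc n b g = begin
    (θ (abelCompanion b) ⋆ g) (suc n)              ≡⟨ ⋆-congʳ (suc n) g (θ-abelCompanion b) ⟩
    (shift (λ j → bC j +ℚ mθC j) ⋆ g) (suc n)      ≡⟨ shift-⋆-suc n (λ j → bC j +ℚ mθC j) g ⟩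
    ((λ j → bC j +ℚ mθC j) ⋆ g) n                  ≡⟨ ⋆-distribʳ-+ n bC mθC g ⟩
    (bC ⋆ g) n +ℚ (mθC ⋆ g) n                      ≡⟨ cong₂ _+ℚ_ (⋆-*ˡ n (fromℕ (b + m)) (abelCompanion (b + m)) g)
                                                                 (⋆-*ˡ n (fromℕ m) (θ (abelCompanion (b + m))) g) ⟩
    fromℕ (b + m) *ℚ (abelCompanion (b + m) ⋆ g) n +ℚ fromℕ m *ℚ (θ (abelCompanion (b + m)) ⋆ g) n ∎
    where
    bC mθC : Seq
    bC  j = fromℕ (b + m) *ℚ abelCompanion (b + m) j
    mθC j = fromℕ m *ℚ θ (abelCompanion (b + m)) j

  abelCompanion-⋆ : ∀ n b g →
    (abelCompanion b ⋆ g) n ≡ (abel b ⋆ g) n +ℚ fromℕ m *ℚ (shift (abelCompanion (b + m)) ⋆ g) n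
  abelCompanion-⋆ n b g = begin
    (abelCompanion b ⋆ g) n                          ≡⟨ ⋆-congʳ n g (abelCompanion≡abel+shift b) ⟩
    ((λ j → abel b j +ℚ mS j) ⋆ g) n                 ≡⟨ ⋆-distribʳ-+ n (abel b) mS g ⟩
    (abel b ⋆ g) n +ℚ (mS ⋆ g) n                     ≡⟨ cong ((abel b ⋆ g) n +ℚ_)
                                                             (⋆-*ˡ n (fromℕ m) (shift (abelCompanion (b + m))) g) ⟩
    (abel b ⋆ g) n +ℚ fromℕ m *ℚ (shift (abelCompanion (b + m)) ⋆ g) n ∎
    where
    mS : Seq
    mS j = fromℕ m *ℚ shift (abelCompanion (b + m)) j

  b+[a+m]≡[a+b]+m : ∀ a b → b + (a + m) ≡ (a + b) + m
  b+[a+m]≡[a+b]+m a b = trans (sym (ℕ.+-assoc b a m)) (cong (_+ m) (ℕ.+-comm b a))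

  abel-⋆-abelCompanion : ∀ n a b → (abel a ⋆ abelCompanion b) n ≡ abelCompanion (a + b) n
  abel-⋆-abelCompanion zero    a b =
    trans (cong₂ _*ℚ_ (abel-0 a) (abelCompanion-0 b)) (sym (abelCompanion-0 (a + b)))
  abel-⋆-abelCompanion (suc n) a b = fromℕ-*-cancelˡ (suc n) (begin
    θ (abel a ⋆ abelCompanion b) (suc n)
      ≡⟨ θ-⋆ (suc n) (abel a) (abelCompanion b) ⟩
    (θ (abel a) ⋆ abelCompanion b) (suc n) +ℚ (abel a ⋆ θ (abelCompanion b)) (suc n)
      ≡⟨ cong₂ _+ℚ_ (θ-abel-⋆-suc n a (abelCompanion b))
                    (trans (⋆-comm (abel a) (θ (abelCompanion b)) (suc n))
                           (θ-abelCompanion-⋆-suc n b (abel a))) ⟩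
    A *ℚ (abelCompanion (a + m) ⋆ abelCompanion b) n +ℚ (B′ *ℚ Q₂ +ℚ M *ℚ Q₃)
      ≡⟨ cong (λ z → A *ℚ z +ℚ (B′ *ℚ Q₂ +ℚ M *ℚ Q₃)) Q₁-split ⟩
    A *ℚ (D +ℚ M *ℚ X) +ℚ (B′ *ℚ Q₂ +ℚ M *ℚ Q₃)
      ≡⟨ solve 7 (λ a d m x b q₂ q₃ → a :* (d :+ m :* x) :+ (b :* q₂ :+ m :* q₃)
                                     := a :* d :+ b :* q₂ :+ m :* (q₃ :+ a :* x))
               refl A D M X B′ Q₂ Q₃ ⟩
    A *ℚ D +ℚ B′ *ℚ Q₂ +ℚ M *ℚ (Q₃ +ℚ A *ℚ X)
      ≡⟨ cong (λ z → A *ℚ D +ℚ B′ *ℚ Q₂ +ℚ M *ℚ z) θ-Q₂ ⟨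
    A *ℚ D +ℚ B′ *ℚ Q₂ +ℚ M *ℚ (fromℕ n *ℚ Q₂)
      ≡⟨ cong₂ (λ d q → A *ℚ d +ℚ B′ *ℚ q +ℚ M *ℚ (fromℕ n *ℚ q)) D≡E Q₂≡E ⟩
    A *ℚ E +ℚ B′ *ℚ E +ℚ M *ℚ θ (abelCompanion ((a + b) + m)) n
      ≡⟨ cong (_+ℚ M *ℚ θ (abelCompanion ((a + b) + m)) n) (*-distribʳ-+ E A B′) ⟨
    (A +ℚ B′) *ℚ E +ℚ M *ℚ θ (abelCompanion ((a + b) + m)) n
      ≡⟨ cong (λ z → z *ℚ E +ℚ M *ℚ θ (abelCompanion ((a + b) + m)) n)
              (trans (sym (fromℕ-homo-+ a (b + m))) (cong fromℕ (sym (ℕ.+-assoc a b m)))) ⟩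
    fromℕ ((a + b) + m) *ℚ E +ℚ M *ℚ θ (abelCompanion ((a + b) + m)) n
      ≡⟨ θ-abelCompanion (a + b) (suc n) ⟨
    θ (abelCompanion (a + b)) (suc n) ∎)
    where
    A B′ M Q₂ Q₃ D X E : ℚ
    A  = fromℕ a
    B′ = fromℕ (b + m)
    M  = fromℕ m
    Q₂ = (abelCompanion (b + m) ⋆ abel a) n
    Q₃ = (θ (abelCompanion (b + m)) ⋆ abel a) n
    D  = (abel b ⋆ abelCompanion (a + m)) n
    X  = (shift (abelCompanion (a + m)) ⋆ abelCompanion (b + m)) n
    E  = abelCompanion ((a + b) + m) n
    Q₁-split : (abelCompanion (a + m) ⋆ abelCompanion b) n ≡ D +ℚ M *ℚ X
    Q₁-split = begin
      (abelCompanion (a + m) ⋆ abelCompanion b) n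
        ≡⟨ ⋆-comm (abelCompanion (a + m)) (abelCompanion b) n ⟩
      (abelCompanion b ⋆ abelCompanion (a + m)) n
        ≡⟨ abelCompanion-⋆ n b (abelCompanion (a + m)) ⟩
      D +ℚ M *ℚ (shift (abelCompanion (b + m)) ⋆ abelCompanion (a + m)) n
        ≡⟨ cong (λ z → D +ℚ M *ℚ z) (shift-⋆-swap n (abelCompanion (b + m)) (abelCompanion (a + m))) ⟩
      D +ℚ M *ℚ X ∎
    θ-Q₂ : fromℕ n *ℚ Q₂ ≡ Q₃ +ℚ A *ℚ X
    θ-Q₂ = trans (θ-⋆ n (abelCompanion (b + m)) (abel a))
      (cong (Q₃ +ℚ_) (trans (⋆-comm (abelCompanion (b + m)) (θ (abel a)) n)
                             (θ-abel-⋆ n a (abelCompanion (b + m)))))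
    D≡E : D ≡ E
    D≡E = trans (abel-⋆-abelCompanion n b (a + m)) (cong (λ k → abelCompanion k n) (b+[a+m]≡[a+b]+m a b))
    Q₂≡E : Q₂ ≡ E
    Q₂≡E = trans (⋆-comm (abelCompanion (b + m)) (abel a) n)
      (trans (abel-⋆-abelCompanion n a (b + m)) (cong (λ k → abelCompanion k n) (sym (ℕ.+-assoc a b m))))

  abel-⋆ : ∀ n a b → (abel a ⋆ abel b) n ≡ abel (a + b) n
  abel-⋆ zero    a b = trans (cong₂ _*ℚ_ (abel-0 a) (abel-0 b)) (sym (abel-0 (a + b)))
  abel-⋆ (suc n) a b = fromℕ-*-cancelˡ (suc n) (begin
    θ (abel a ⋆ abel b) (suc n)
      ≡⟨ θ-⋆ (suc n) (abel a) (abel b) ⟩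
    (θ (abel a) ⋆ abel b) (suc n) +ℚ (abel a ⋆ θ (abel b)) (suc n)
      ≡⟨ cong ((θ (abel a) ⋆ abel b) (suc n) +ℚ_) (⋆-comm (abel a) (θ (abel b)) (suc n)) ⟩
    (θ (abel a) ⋆ abel b) (suc n) +ℚ (θ (abel b) ⋆ abel a) (suc n)
      ≡⟨ cong₂ _+ℚ_ (θ-abel-⋆-suc n a (abel b)) (θ-abel-⋆-suc n b (abel a)) ⟩
    fromℕ a *ℚ (abelCompanion (a + m) ⋆ abel b) n +ℚ fromℕ b *ℚ (abelCompanion (b + m) ⋆ abel a) n
      ≡⟨ cong₂ (λ u v → fromℕ a *ℚ u +ℚ fromℕ b *ℚ v) (companion≡E b a (b+[a+m]≡[a+b]+m a b))
                                                        (companion≡E a b (sym (ℕ.+-assoc a b m))) ⟩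
    fromℕ a *ℚ E +ℚ fromℕ b *ℚ E
      ≡⟨ *-distribʳ-+ E (fromℕ a) (fromℕ b) ⟨
    (fromℕ a +ℚ fromℕ b) *ℚ E
      ≡⟨ cong (_*ℚ E) (fromℕ-homo-+ a b) ⟨
    fromℕ (a + b) *ℚ E
      ≡⟨ θ-abel (a + b) (suc n) ⟨
    θ (abel (a + b)) (suc n) ∎)
    where
    E : ℚ
    E = abelCompanion ((a + b) + m) n
    companion≡E : ∀ c d → c + (d + m) ≡ (a + b) + m → (abelCompanion (d + m) ⋆ abel c) n ≡ E
    companion≡E c d eq = trans (⋆-comm (abelCompanion (d + m)) (abel c) n)
      (trans (abel-⋆-abelCompanion n c (d + m)) (cong (λ k → abelCompanion k n) eq))

module ReciprocalHookWeights (m : ℕ) where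
  open import Data.Nat using (zero; suc; _+_; _*_; _!)
  import Data.Nat.Properties as ℕ
  open import Data.Nat.Solver using (module +-*-Solver)
  open import Data.Rational using (ℚ; 0ℚ; 1ℚ) renaming (_*_ to _*ℚ_)
  open import Data.Rational.Properties
  open import Data.Rational.Solver renaming (module +-*-Solver to ℚ-Solver)
  open import Relation.Binary.PropositionalEquality
  open ≡-Reasoning
  open import Defs using (inv; ⟦_⟧; prodMI; ΣT; 𝒯; hookProd)
  open NatEmbedding
  open BinomialSeries m
  open HookSums (suc m)
  open Weighted inv

  fromℕ-suc-*-inv-* : ∀ n z → fromℕ (suc n) *ℚ (inv (suc n) *ℚ z) ≡ z
  fromℕ-suc-*-inv-* n z = begin
    fromℕ (suc n) *ℚ (inv (suc n) *ℚ z)     ≡⟨ cong (λ x → fromℕ (suc n) *ℚ (x *ℚ z)) (1/ℕ≡1/ (suc n)) ⟨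
    fromℕ (suc n) *ℚ (1/ℕ (suc n) *ℚ z)    ≡⟨ *-assoc (fromℕ (suc n)) _ z ⟨
    fromℕ (suc n) *ℚ 1/ℕ (suc n) *ℚ z      ≡⟨ cong (_*ℚ z) (fromℕ-*-1/ℕ (suc n)) ⟩
    1ℚ *ℚ z                                ≡⟨ *-identityˡ z ⟩
    z                                      ∎

  pochhammer-0-suc : ∀ n → pochhammer 0 (suc n) ≡ 0
  pochhammer-0-suc zero    = cong (λ x → 1 * (x + 0)) (ℕ.*-zeroʳ m)
  pochhammer-0-suc (suc n) = cong (_* (m * suc n + 0)) (pochhammer-0-suc n)

  pochhammer-1-suc : ∀ n → pochhammer 1 (suc n) ≡ pochhammer (suc m) n
  pochhammer-1-suc zero    = cong (λ x → 1 * (x + 1)) (ℕ.*-zeroʳ m)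
  pochhammer-1-suc (suc n) = cong₂ _*_ (pochhammer-1-suc n)
    (solve 2 (λ m n → m :* (con 1 :+ n) :+ con 1 := m :* n :+ (con 1 :+ m)) refl m n)
    where open +-*-Solver

  pochhammer-1≡prodMI : ∀ n → pochhammer 1 n ≡ prodMI m n
  pochhammer-1≡prodMI zero    = refl
  pochhammer-1≡prodMI (suc n) = cong (_* (m * n + 1)) (pochhammer-1≡prodMI n)

  inv-*-binomial : ∀ n → inv (suc n) *ℚ binomial (suc m) n ≡ binomial 1 (suc n)
  inv-*-binomial n = fromℕ-*-cancelˡ (suc n) (begin
    fromℕ (suc n) *ℚ (inv (suc n) *ℚ binomial (suc m) n)    ≡⟨ fromℕ-suc-*-inv-* n (binomial (suc m) n) ⟩
    fromℕ (pochhammer (suc m) n) *ℚ invFact n             ≡⟨ cong (λ k → fromℕ k *ℚ invFact n) (pochhammer-1-suc n) ⟨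
    fromℕ (pochhammer 1 (suc n)) *ℚ invFact n
      ≡⟨ fromℕ-suc-*-scaled-invFact n (fromℕ (pochhammer 1 (suc n))) ⟨
    fromℕ (suc n) *ℚ binomial 1 (suc n)                    ∎)

  binomial-isTreePowerFamily : IsTreePowerFamily binomial
  binomial-isTreePowerFamily = record
    { F₀≡δ   = binomial₀≡δ
    ; F₁-0   = binomial-0 1
    ; F₁⋆F   = λ k n → binomial-⋆ n 1 k
    ; F₁-suc = inv-*-binomial
    }
    where
    binomial₀≡δ : ∀ n → binomial 0 n ≡ δ n
    binomial₀≡δ zero    = binomial-0 0
    binomial₀≡δ (suc n) = begin
      fromℕ (pochhammer 0 (suc n)) *ℚ invFact (suc n) ≡⟨ cong (λ k → fromℕ k *ℚ invFact (suc n)) (pochhammer-0-suc n) ⟩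
      fromℕ 0 *ℚ invFact (suc n)                      ≡⟨ cong (_*ℚ invFact (suc n)) fromℕ-0 ⟩
      0ℚ *ℚ invFact (suc n)                           ≡⟨ *-zeroˡ (invFact (suc n)) ⟩
      0ℚ                                              ∎

  n!-*-hookSum : ∀ n → ⟦ n ! ⟧ *ℚ ΣT (𝒯 (suc m) n) (hookProd inv) ≡ ⟦ prodMI m n ⟧
  n!-*-hookSum n = begin
    ⟦ n ! ⟧ *ℚ ΣT (𝒯 (suc m) n) (hookProd inv)
      ≡⟨ cong₂ _*ℚ_ (sym (fromℕ≡⟦⟧ (n !))) (hookSum≡F₁ binomial-isTreePowerFamily n) ⟩
    fromℕ (n !) *ℚ (fromℕ (pochhammer 1 n) *ℚ invFact n)
      ≡⟨ solve 3 (λ f p i → f :* (p :* i) := p :* (f :* i)) refl (fromℕ (n !)) (fromℕ (pochhammer 1 n)) (invFact n) ⟩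
    fromℕ (pochhammer 1 n) *ℚ (fromℕ (n !) *ℚ invFact n)
      ≡⟨ cong (fromℕ (pochhammer 1 n) *ℚ_) (fromℕ-!-*-invFact n) ⟩
    fromℕ (pochhammer 1 n) *ℚ 1ℚ
      ≡⟨ *-identityʳ _ ⟩
    fromℕ (pochhammer 1 n)
      ≡⟨ trans (cong fromℕ (pochhammer-1≡prodMI n)) (fromℕ≡⟦⟧ (prodMI m n)) ⟩
    ⟦ prodMI m n ⟧ ∎
    where open ℚ-Solver using (solve; _:*_; _:=_)

module ShiftedReciprocalHookWeights (m : ℕ) where
  open import Data.Nat using (zero; suc; _+_; _*_; _^_; _∸_; _!)
  import Data.Nat.Properties as ℕ
  open import Data.Nat.Solver using (module +-*-Solver)
  open import Data.Rational using (ℚ; 0ℚ) renaming (_+_ to _+ℚ_; _*_ to _*ℚ_)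
  open import Data.Rational.Properties
  open import Data.Rational.Solver renaming (module +-*-Solver to ℚ-Solver)
  open import Relation.Binary.PropositionalEquality
  open ≡-Reasoning
  open import Defs using (inv; ⟦_⟧; divFact; ΣT; 𝒯; hookProd)
  open NatEmbedding
  open Convolution
  open AbelSeries m
  open HookSums (suc m)

  weight : ℕ → ℚ
  weight h = ⟦ m ⟧ +ℚ inv h

  open Weighted weight

  fromℕ-suc-*-weight-* : ∀ n z → fromℕ (suc n) *ℚ (weight (suc n) *ℚ z) ≡ fromℕ (m * suc n + 1) *ℚ z
  fromℕ-suc-*-weight-* n z = begin
    fromℕ (suc n) *ℚ ((⟦ m ⟧ +ℚ inv (suc n)) *ℚ z)
      ≡⟨ cong₂ (λ a b → fromℕ (suc n) *ℚ ((a +ℚ b) *ℚ z)) (fromℕ≡⟦⟧ m) (1/ℕ≡1/ (suc n)) ⟨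
    fromℕ (suc n) *ℚ ((fromℕ m +ℚ 1/ℕ (suc n)) *ℚ z)
      ≡⟨ solve 4 (λ s a b z → s :* ((a :+ b) :* z) := (a :* s :+ s :* b) :* z)
               refl (fromℕ (suc n)) (fromℕ m) (1/ℕ (suc n)) z ⟩
    (fromℕ m *ℚ fromℕ (suc n) +ℚ fromℕ (suc n) *ℚ 1/ℕ (suc n)) *ℚ z
      ≡⟨ cong (λ u → (fromℕ m *ℚ fromℕ (suc n) +ℚ u) *ℚ z) (trans (fromℕ-*-1/ℕ (suc n)) (sym fromℕ-1)) ⟩
    (fromℕ m *ℚ fromℕ (suc n) +ℚ fromℕ 1) *ℚ z
      ≡⟨ cong (_*ℚ z) (trans (fromℕ-homo-+ (m * suc n) 1) (cong (_+ℚ fromℕ 1) (fromℕ-homo-* m (suc n)))) ⟨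
    fromℕ (m * suc n + 1) *ℚ z ∎
    where open ℚ-Solver using (solve; _:+_; _:*_; _:=_)

  r : ℕ
  r = suc m

  numerator-recurrence : ∀ n → (m * suc n + 1) * (r ^ n * abelNumerator r n) ≡ r ^ suc n * abelNumerator 1 (suc n)
  numerator-recurrence zero    = solve 1 (λ m → (m :* con 1 :+ con 1) :* (con 1 :* con 1)
                                       := ((con 1 :+ m) :* con 1) :* (con 1 :* con 1)) refl m
    where open +-*-Solver
  numerator-recurrence (suc n) = begin
    (m * suc (suc n) + 1) * (r ^ suc n * (r * (r + m * suc n) ^ n))
      ≡⟨ cong₂ (λ u v → u * (r ^ suc n * (r * v ^ n))) (ℕ.+-comm (m * suc (suc n)) 1)
                                                      (cong suc (sym (ℕ.*-suc m (suc n)))) ⟩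
    Y * (r ^ suc n * (r * Y ^ n))
      ≡⟨ solve 4 (λ y a r b → y :* (a :* (r :* b)) := (r :* a) :* (con 1 :* (y :* b))) refl Y (r ^ suc n) r (Y ^ n) ⟩
    r ^ suc (suc n) * abelNumerator 1 (suc (suc n)) ∎
    where
    open +-*-Solver
    Y : ℕ
    Y = 1 + m * suc (suc n)

  twistedAbel : ℕ → Seq
  twistedAbel k = twist r (abel k)

  weight-*-twistedAbel : ∀ n → weight (suc n) *ℚ twistedAbel r n ≡ twistedAbel 1 (suc n)
  weight-*-twistedAbel n = fromℕ-*-cancelˡ (suc n) (begin
    fromℕ (suc n) *ℚ (weight (suc n) *ℚ twistedAbel r n)
      ≡⟨ fromℕ-suc-*-weight-* n (twistedAbel r n) ⟩
    fromℕ (m * suc n + 1) *ℚ (fromℕ (r ^ n) *ℚ (fromℕ (abelNumerator r n) *ℚ invFact n))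
      ≡⟨ trans (cong (fromℕ (m * suc n + 1) *ℚ_) (fromℕ-*-fromℕ-* (r ^ n) _ (invFact n)))
               (fromℕ-*-fromℕ-* (m * suc n + 1) _ (invFact n)) ⟩
    fromℕ ((m * suc n + 1) * (r ^ n * abelNumerator r n)) *ℚ invFact n
      ≡⟨ cong (λ k → fromℕ k *ℚ invFact n) (numerator-recurrence n) ⟩
    fromℕ (r ^ suc n * abelNumerator 1 (suc n)) *ℚ invFact n
      ≡⟨ fromℕ-*-fromℕ-* (r ^ suc n) _ (invFact n) ⟨
    fromℕ (r ^ suc n) *ℚ (fromℕ (abelNumerator 1 (suc n)) *ℚ invFact n)
      ≡⟨ cong (fromℕ (r ^ suc n) *ℚ_) (fromℕ-suc-*-scaled-invFact n (fromℕ (abelNumerator 1 (suc n)))) ⟨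
    fromℕ (r ^ suc n) *ℚ (fromℕ (suc n) *ℚ abel 1 (suc n))
      ≡⟨ solve 3 (λ a s x → a :* (s :* x) := s :* (a :* x)) refl (fromℕ (r ^ suc n)) (fromℕ (suc n)) (abel 1 (suc n)) ⟩
    fromℕ (suc n) *ℚ twistedAbel 1 (suc n) ∎)
    where open ℚ-Solver using (solve; _:*_; _:=_)

  twistedAbel-isTreePowerFamily : IsTreePowerFamily twistedAbel
  twistedAbel-isTreePowerFamily = record
    { F₀≡δ   = twistedAbel₀≡δ
    ; F₁-0   = cong₂ _*ℚ_ fromℕ-1 (abel-0 1)
    ; F₁⋆F   = λ k n → trans (twist-⋆ r n (abel 1) (abel k)) (cong (fromℕ (r ^ n) *ℚ_) (abel-⋆ n 1 k))
    ; F₁-suc = weight-*-twistedAbel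
    }
    where
    twistedAbel₀≡δ : ∀ n → twistedAbel 0 n ≡ δ n
    twistedAbel₀≡δ zero    = cong₂ _*ℚ_ fromℕ-1 (abel-0 0)
    twistedAbel₀≡δ (suc n) = begin
      fromℕ (r ^ suc n) *ℚ (fromℕ 0 *ℚ invFact (suc n)) ≡⟨ cong (λ z → fromℕ (r ^ suc n) *ℚ (z *ℚ invFact (suc n))) fromℕ-0 ⟩
      fromℕ (r ^ suc n) *ℚ (0ℚ *ℚ invFact (suc n))      ≡⟨ cong (fromℕ (r ^ suc n) *ℚ_) (*-zeroˡ (invFact (suc n))) ⟩
      fromℕ (r ^ suc n) *ℚ 0ℚ                           ≡⟨ *-zeroʳ (fromℕ (r ^ suc n)) ⟩
      0ℚ                                                ∎

  numerator-closedForm : ∀ n → r ^ n * abelNumerator 1 n ≡ suc m ^ n * (m * n + 1) ^ (n ∸ 1)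
  numerator-closedForm zero    = refl
  numerator-closedForm (suc n) =
    cong (r ^ suc n *_) (trans (ℕ.*-identityˡ _) (cong (_^ n) (ℕ.+-comm 1 (m * suc n))))

  hookSum : ∀ n → ΣT (𝒯 (suc m) n) (hookProd weight) ≡ divFact ⟦ suc m ^ n * (m * n + 1) ^ (n ∸ 1) ⟧ n
  hookSum n = begin
    ΣT (𝒯 (suc m) n) (hookProd weight)                         ≡⟨ hookSum≡F₁ twistedAbel-isTreePowerFamily n ⟩
    fromℕ (r ^ n) *ℚ (fromℕ (abelNumerator 1 n) *ℚ invFact n)  ≡⟨ fromℕ-*-fromℕ-* (r ^ n) _ (invFact n) ⟩
    fromℕ (r ^ n * abelNumerator 1 n) *ℚ invFact n
      ≡⟨ cong₂ _*ℚ_ (trans (cong fromℕ (numerator-closedForm n)) (fromℕ≡⟦⟧ _)) (1/ℕ≡1/ (n !) {{n ℕ.!≢0}}) ⟩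
    divFact ⟦ suc m ^ n * (m * n + 1) ^ (n ∸ 1) ⟧ n            ∎

open import Defs
open import Data.Nat using (suc; _+_; _*_; _∸_; _^_; _!)
open import Data.Rational using () renaming (_+_ to _+ℚ_; _*_ to _*ℚ_)
open import Data.Product using (_×_; _,_)
open import Relation.Binary.PropositionalEquality using (_≡_)

corollary3p5 : (m n : ℕ) →
    (⟦ n ! ⟧ *ℚ ΣT (𝒯 (suc m) n) (hookProd inv) ≡ ⟦ prodMI m n ⟧)
    × (ΣT (𝒯 (suc m) n) (hookProd (λ h → ⟦ m ⟧ +ℚ inv h))
        ≡ divFact ⟦ suc m ^ n * (m * n + 1) ^ (n ∸ 1) ⟧ n)
corollary3p5 m n = ReciprocalHookWeights.n!-*-hookSum m n , ShiftedReciprocalHookWeights.hookSum m n
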